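{- Let $g\geq3$ and $K\geq1$ be integers. Let $j,k\in\mathbb{N}$ with $\gcd(k,g)=1$ and $j\not\equiv0\pmod k$. Then \[w_K(j/k)>\frac{K}{\lceil\log_gk\rceil}-1.\]
   Context: Centred base-$g$ expansion: $\mathcal{R}_g=\{ -\frac{g-1}{2},\ldots,\frac{g-1}{2}\}$, $I_g=(-\frac12,\frac12]$ for odd $g$; $\mathcal{R}_g=\{ -\frac{g-2}{2},\ldots,\frac g2\}$, $I_g=(-\frac{g-2}{2(g-1)},\frac{g}{2(g-1)}]$ for even $g$. Every real $\alpha$ is $n+\sum_{i\geq1}\alpha_ig^{ -i}$ with $n\in\mathbb{Z}$, the sum lying in $I_g$, $\alpha_i\in\mathcal{R}_g$ (unique, preferring the expansion eventually all $\min\mathcal{R}_g$ to one eventually all $\max\mathcal{R}_g$). $w_K(\alpha)=\#\{1\leq i\leq K:\alpha_i\neq0\}$, the number of non-zero digits among the first $K$ digits after the radix point. -}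

module Defs where

import Data.Nat as ℕ
open ℕ using (ℕ; zero; suc; _^_; _≤?_; _%_)
open import Data.Integer as ℤ using (ℤ; +_)
import Data.Rational as ℚ
open ℚ using (ℚ; _/_; _*_; _-_; _≟_)
open import Data.Bool using (Bool; true; false; if_then_else_)
open import Relation.Nullary using (yes; no)

-- upper endpoint b_g of the interval I_g = (b_g - 1, b_g]
--   odd g : b_g = 1/2 ;  even g : b_g = g / (2(g-1))   (g ≥ 2 assumed when used)
upperI : ℕ → ℚ
upperI g with g % 2
... | 0 = (+ g) / suc (2 ℕ.* (g ℕ.∸ 2) ℕ.+ 1)   -- denominator 2(g-1) = 2(g-2)+2
... | _ = (+ 1) / 2

-- the unique representative of x modulo 1 lying in I_g = (b_g - 1, b_g]
-- (x - ⌈x - b_g⌉)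
redI : ℕ → ℚ → ℚ
redI g x = x - (ℚ.ceiling (x - upperI g) / 1)

gQ : ℕ → ℚ
gQ g = (+ g) / 1

fracPart : ℕ → ℚ → ℕ → ℚ
fracPart g α i = redI g (gQ (g ^ i) * α)

digit : ℕ → ℚ → ℕ → ℚ
digit g α i = gQ g * fracPart g α (i ℕ.∸ 1) - fracPart g α i

w : ℕ → ℕ → ℚ → ℕ
w g zero α = 0
w g (suc K) α with digit g α (suc K) ≟ ℚ.0ℚ
... | yes _ = w g K α
... | no  _ = suc (w g K α)

clogAux : ℕ → ℕ → ℕ → ℕ → ℕ
clogAux g k zero L = L
clogAux g k (suc fuel) L with k ≤? g ^ L
... | yes _ = L
... | no  _ = clogAux g k fuel (suc L)

ceilLog : ℕ → ℕ → ℕ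
ceilLog g k = clogAux g k k 0

{-# OPTIONS --safe #-}
-- Let f_i ∈ I_g ⊂ (-1, 1) be the centred fractional part of g^i j/k, so that the i-th digit is
-- g f_{i-1} - f_i.  Then r_i = k f_i is an integer congruent to g^i j modulo k; as k is coprime
-- to g and does not divide j, r_i ≠ 0, so 1 ≤ |r_i| < k.  A zero digit at position i + 1 means
-- r_{i+1} = g r_i, so after a run of z zero digits g^z ≤ |r| < k ≤ g^L with L = ⌈log_g k⌉,
-- i.e. z < L.  Every block of L consecutive digits thus contains a non-zero one, which gives
-- K < (w_K + 1) L.
module Submission where

open import Defs
open import Data.Nat using (ℕ; _≥_; _*_; _+_; _<_; NonZero)
open import Data.Nat.GCD using (gcd)
open import Data.Nat.Divisibility using (_∣_)
open import Data.Integer using (+_)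
open import Data.Rational using (_/_)
open import Relation.Binary.PropositionalEquality using (_≡_)
open import Relation.Nullary using (¬_)

open import Data.Nat as ℕ using (zero; suc; _≤_; _^_; z≤n; s≤s)
import Data.Nat.Properties as ℕ
open import Data.Nat.Coprimality using (Coprime; coprime-divisor; gcd≡1⇒coprime)
open import Data.Nat.Divisibility using (divides)
open import Data.Integer as ℤ using (ℤ; -[1+_]; 0ℤ; 1ℤ; -<-; +<+)
import Data.Integer.Properties as ℤ
open import Data.Integer.DivMod using ([n/d]*d≤n; n<s[n/ℕd]*d; div-pos-is-/ℕ)
open import Data.Rational as ℚ using (ℚ; mkℚ; toℚᵘ; 0ℚ; 1ℚ)
import Data.Rational.Properties as ℚ
open import Data.Rational.Solver using (module +-*-Solver)
open import Data.Nat.Tactic.RingSolver using (solve-∀)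
open import Data.Rational.Unnormalised as ℚᵘ using (mkℚᵘ; *≡*; *≤*; *<*)
import Data.Rational.Unnormalised.Properties as ℚᵘ
open import Algebra.Properties.Group ℚ.+-0-group using (x∙y⁻¹≈ε⇒x≈y; ⁻¹-involutive)
open import Data.Product using (_×_; _,_; proj₁; proj₂; ∃-syntax)
open import Relation.Binary.PropositionalEquality using (refl; sym; trans; cong; cong₂; subst; subst₂; _≢_; module ≡-Reasoning)
open import Relation.Nullary using (yes; no)

ι : ℤ → ℚ
ι z = z / 1

toℚᵘ-ι : ∀ z → toℚᵘ (ι z) ℚᵘ.≃ mkℚᵘ z 0
toℚᵘ-ι z = ℚ.toℚᵘ-fromℚᵘ (mkℚᵘ z 0)

ι-homo-+ : ∀ a b → ι (a ℤ.+ b) ≡ ι a ℚ.+ ι b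
ι-homo-+ a b = ℚ.toℚᵘ-injective (begin
  toℚᵘ (ι (a ℤ.+ b))          ≈⟨ toℚᵘ-ι (a ℤ.+ b) ⟩
  mkℚᵘ (a ℤ.+ b) 0             ≈⟨ *≡* (cong (ℤ._* 1ℤ) (cong₂ ℤ._+_ (sym (ℤ.*-identityʳ a))
                                                                   (sym (ℤ.*-identityʳ b)))) ⟩
  mkℚᵘ a 0 ℚᵘ.+ mkℚᵘ b 0       ≈⟨ ℚᵘ.+-cong (toℚᵘ-ι a) (toℚᵘ-ι b) ⟨
  toℚᵘ (ι a) ℚᵘ.+ toℚᵘ (ι b)   ≈⟨ ℚ.toℚᵘ-homo-+ (ι a) (ι b) ⟨
  toℚᵘ (ι a ℚ.+ ι b)           ∎)
  where open ℚᵘ.≃-Reasoning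

ι-homo-* : ∀ a b → ι (a ℤ.* b) ≡ ι a ℚ.* ι b
ι-homo-* a b = ℚ.toℚᵘ-injective (begin
  toℚᵘ (ι (a ℤ.* b))          ≈⟨ toℚᵘ-ι (a ℤ.* b) ⟩
  mkℚᵘ (a ℤ.* b) 0             ≈⟨ *≡* refl ⟩
  mkℚᵘ a 0 ℚᵘ.* mkℚᵘ b 0       ≈⟨ ℚᵘ.*-cong (toℚᵘ-ι a) (toℚᵘ-ι b) ⟨
  toℚᵘ (ι a) ℚᵘ.* toℚᵘ (ι b)   ≈⟨ ℚ.toℚᵘ-homo-* (ι a) (ι b) ⟨
  toℚᵘ (ι a ℚ.* ι b)           ∎)
  where open ℚᵘ.≃-Reasoning

ι-homo-neg : ∀ a → ι (ℤ.- a) ≡ ℚ.- ι a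
ι-homo-neg a = ℚ.toℚᵘ-injective (begin
  toℚᵘ (ι (ℤ.- a))   ≈⟨ toℚᵘ-ι (ℤ.- a) ⟩
  mkℚᵘ (ℤ.- a) 0      ≈⟨ ℚᵘ.-‿cong (toℚᵘ-ι a) ⟨
  ℚᵘ.- toℚᵘ (ι a)     ≈⟨ ℚ.toℚᵘ-homo‿- (ι a) ⟨
  toℚᵘ (ℚ.- ι a)      ∎)
  where open ℚᵘ.≃-Reasoning

ι-homo-- : ∀ a b → ι (a ℤ.- b) ≡ ι a ℚ.- ι b
ι-homo-- a b = trans (ι-homo-+ a (ℤ.- b)) (cong (ι a ℚ.+_) (ι-homo-neg b))

ι-injective : ∀ {a b} → ι a ≡ ι b → a ≡ b
ι-injective {a} {b} ιa≡ιb with ℚᵘ.≃-trans (ℚᵘ.≃-sym (toℚᵘ-ι a)) (ℚᵘ.≃-trans (ℚ.toℚᵘ-cong ιa≡ιb) (toℚᵘ-ι b))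
... | *≡* a*1≡b*1 = trans (sym (ℤ.*-identityʳ a)) (trans a*1≡b*1 (ℤ.*-identityʳ b))

ι-cancel-< : ∀ {a b} → ι a ℚ.< ι b → a ℤ.< b
ι-cancel-< {a} {b} ιa<ιb with ℚᵘ.<-respʳ-≃ (toℚᵘ-ι b) (ℚᵘ.<-respˡ-≃ (toℚᵘ-ι a) (ℚ.toℚᵘ-mono-< ιa<ιb))
... | *<* a*1<b*1 = subst₂ ℤ._<_ (ℤ.*-identityʳ a) (ℤ.*-identityʳ b) a*1<b*1

ι[k]*[n/k]≡ι[n] : ∀ n k .{{_ : NonZero k}} → ι (+ k) ℚ.* (n / k) ≡ ι n
ι[k]*[n/k]≡ι[n] n k@(suc k-1) = ℚ.toℚᵘ-injective (begin
  toℚᵘ (ι (+ k) ℚ.* (n / k))          ≈⟨ ℚ.toℚᵘ-homo-* (ι (+ k)) (n / k) ⟩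
  toℚᵘ (ι (+ k)) ℚᵘ.* toℚᵘ (n / k)   ≈⟨ ℚᵘ.*-cong (toℚᵘ-ι (+ k)) (ℚ.toℚᵘ-fromℚᵘ (mkℚᵘ n k-1)) ⟩
  mkℚᵘ (+ k) 0 ℚᵘ.* mkℚᵘ n k-1       ≈⟨ *≡* (trans (ℤ.*-identityʳ (+ k ℤ.* n))
                                             (trans (ℤ.*-comm (+ k) n) (cong (λ m → n ℤ.* + m) (sym (ℕ.*-identityˡ k))))) ⟩
  mkℚᵘ n 0                            ≈⟨ toℚᵘ-ι n ⟨
  toℚᵘ (ι n)                          ∎)
  where open ℚᵘ.≃-Reasoning

ι⌊p⌋≤p : ∀ p → ι (ℚ.floor p) ℚ.≤ p
ι⌊p⌋≤p p@(mkℚ n d-1 _) = ℚ.toℚᵘ-cancel-≤ (ℚᵘ.≤-respˡ-≃ (ℚᵘ.≃-sym (toℚᵘ-ι (ℚ.floor p)))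
  (*≤* (subst (ℚ.floor p ℤ.* + suc d-1 ℤ.≤_) (sym (ℤ.*-identityʳ n)) ([n/d]*d≤n n (+ suc d-1)))))

p<ι[1+⌊p⌋] : ∀ p → p ℚ.< ι (ℤ.suc (ℚ.floor p))
p<ι[1+⌊p⌋] p@(mkℚ n d-1 _) = ℚ.toℚᵘ-cancel-< (ℚᵘ.<-respʳ-≃ (ℚᵘ.≃-sym (toℚᵘ-ι (ℤ.suc (ℚ.floor p))))
  (*<* (subst₂ ℤ._<_ (sym (ℤ.*-identityʳ n)) (cong (λ q → ℤ.suc q ℤ.* + suc d-1) (sym (div-pos-is-/ℕ n (suc d-1))))
    (n<s[n/ℕd]*d n (suc d-1)))))

q≤ι⌈q⌉ : ∀ q → q ℚ.≤ ι (ℚ.ceiling q)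
q≤ι⌈q⌉ q@record{} = begin
  q                             ≡⟨ ⁻¹-involutive q ⟨
  ℚ.- (ℚ.- q)                   ≤⟨ ℚ.neg-antimono-≤ (ι⌊p⌋≤p (ℚ.- q)) ⟩
  ℚ.- ι (ℚ.floor (ℚ.- q))       ≡⟨ ι-homo-neg (ℚ.floor (ℚ.- q)) ⟨
  ι (ℚ.ceiling q)               ∎
  where open ℚ.≤-Reasoning

ι⌈q⌉<q+1 : ∀ q → ι (ℚ.ceiling q) ℚ.< q ℚ.+ 1ℚ
ι⌈q⌉<q+1 q@record{} = begin-strict
  ι (ℤ.- F)                     ≡⟨ ι-homo-neg F ⟩
  ℚ.- ι F                       ≡⟨ solve 1 (λ a → :- a := con 1ℚ :- (con 1ℚ :+ a)) refl (ι F) ⟩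
  1ℚ ℚ.- (1ℚ ℚ.+ ι F)           ≡⟨ cong (λ a → 1ℚ ℚ.- a) (ι-homo-+ 1ℤ F) ⟨
  1ℚ ℚ.- ι (ℤ.suc F)            <⟨ ℚ.+-monoʳ-< 1ℚ (ℚ.neg-antimono-< (p<ι[1+⌊p⌋] (ℚ.- q))) ⟩
  1ℚ ℚ.- (ℚ.- q)                ≡⟨ solve 1 (λ a → con 1ℚ :- (:- a) := a :+ con 1ℚ) refl q ⟩
  q ℚ.+ 1ℚ                      ∎
  where
  open ℚ.≤-Reasoning
  open +-*-Solver
  F = ℚ.floor (ℚ.- q)

0<+n/d : ∀ {n d} .{{_ : NonZero n}} .{{_ : NonZero d}} → 0ℚ ℚ.< + n / d
0<+n/d {n} {d} = ℚ.positive⁻¹ (+ n / d) {{ℚ.normalize-pos n d}}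

+n/d<1 : ∀ {n d} .{{_ : NonZero d}} → n ℕ.< d → + n / d ℚ.< 1ℚ
+n/d<1 {n} {d@(suc d-1)} n<d = ℚ.toℚᵘ-cancel-< (ℚᵘ.<-respˡ-≃ (ℚᵘ.≃-sym (ℚ.toℚᵘ-fromℚᵘ (mkℚᵘ (+ n) d-1)))
  (*<* (subst₂ ℤ._<_ (sym (ℤ.*-identityʳ (+ n))) (sym (ℤ.*-identityˡ (+ d))) (+<+ n<d))))

g<2[g∸2]+2 : ∀ {g} → 3 ≤ g → g ℕ.< suc (2 * (g ℕ.∸ 2) + 1)
g<2[g∸2]+2 {1} (s≤s ())
g<2[g∸2]+2 {2} (s≤s (s≤s ()))
g<2[g∸2]+2 {suc (suc (suc h))} _ = s≤s (ℕ.≤-trans (ℕ.m≤m+n (3 + h) h) (ℕ.≤-reflexive (eq h)))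
  where
  eq : ∀ h → 3 + h + h ≡ 2 * suc h + 1
  eq = solve-∀

upperI-bounds : ∀ {g} → 3 ≤ g → 0ℚ ℚ.< upperI g × upperI g ℚ.< 1ℚ
upperI-bounds {g} 3≤g with g ℕ.% 2
... | zero  = 0<+n/d {{ℕ.>-nonZero (ℕ.<-≤-trans (s≤s z≤n) 3≤g)}} , +n/d<1 (g<2[g∸2]+2 3≤g)
... | suc _ = 0<+n/d {1} {2} , +n/d<1 {1} {2} (s≤s (s≤s z≤n))

module _ {g : ℕ} (3≤g : 3 ≤ g) (x : ℚ) where
  open ℚ.≤-Reasoning
  open +-*-Solver

  private
    b = upperI g

  redI<1 : redI g x ℚ.< 1ℚ
  redI<1 = begin-strict
    x ℚ.- ι (ℚ.ceiling (x ℚ.- b))    ≤⟨ ℚ.+-monoʳ-≤ x (ℚ.neg-antimono-≤ (q≤ι⌈q⌉ (x ℚ.- b))) ⟩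
    x ℚ.- (x ℚ.- b)                  ≡⟨ solve 2 (λ x b → x :- (x :- b) := b) refl x b ⟩
    b                                <⟨ proj₂ (upperI-bounds 3≤g) ⟩
    1ℚ                               ∎

  -1<redI : ℚ.- 1ℚ ℚ.< redI g x
  -1<redI = begin-strict
    ℚ.- 1ℚ                           ≡⟨ ℚ.+-identityˡ (ℚ.- 1ℚ) ⟨
    0ℚ ℚ.- 1ℚ                        <⟨ ℚ.+-monoˡ-< (ℚ.- 1ℚ) (proj₁ (upperI-bounds 3≤g)) ⟩
    b ℚ.- 1ℚ                         ≡⟨ solve 2 (λ x b → b :- con 1ℚ := x :- ((x :- b) :+ con 1ℚ)) refl x b ⟩
    x ℚ.- ((x ℚ.- b) ℚ.+ 1ℚ)         <⟨ ℚ.+-monoʳ-< x (ℚ.neg-antimono-< (ι⌈q⌉<q+1 (x ℚ.- b))) ⟩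
    x ℚ.- ι (ℚ.ceiling (x ℚ.- b))    ∎

-n<i<n⇒∣i∣<n : ∀ {i n} → ℤ.- + n ℤ.< i → i ℤ.< + n → ℤ.∣ i ∣ ℕ.< n
-n<i<n⇒∣i∣<n {+ _}                 _          (+<+ i<n) = i<n
-n<i<n⇒∣i∣<n { -[1+ _ ]} {suc _}   (-<- i<n)  _         = s≤s i<n

-1<x<1⇒∣k*x∣<k : ∀ {m k x} .{{_ : NonZero k}} → ι (+ k) ℚ.* x ≡ ι m →
                  ℚ.- 1ℚ ℚ.< x → x ℚ.< 1ℚ → ℤ.∣ m ∣ ℕ.< k
-1<x<1⇒∣k*x∣<k {m} {k} {x} kx≡m -1<x x<1 = -n<i<n⇒∣i∣<n {m} (ι-cancel-< -k<m) (ι-cancel-< m<k)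
  where
  open ℚ.≤-Reasoning
  open +-*-Solver
  instance
    k>0 : ℚ.Positive (ι (+ k))
    k>0 = ℚ.normalize-pos k 1

  -k<m : ι (ℤ.- + k) ℚ.< ι m
  -k<m = begin-strict
    ι (ℤ.- + k)             ≡⟨ ι-homo-neg (+ k) ⟩
    ℚ.- ι (+ k)             ≡⟨ solve 1 (λ a → :- a := a :* (:- con 1ℚ)) refl (ι (+ k)) ⟩
    ι (+ k) ℚ.* ℚ.- 1ℚ      <⟨ ℚ.*-monoʳ-<-pos (ι (+ k)) -1<x ⟩
    ι (+ k) ℚ.* x           ≡⟨ kx≡m ⟩
    ι m                     ∎

  m<k : ι m ℚ.< ι (+ k)
  m<k = begin-strict
    ι m                     ≡⟨ kx≡m ⟨
    ι (+ k) ℚ.* x           <⟨ ℚ.*-monoʳ-<-pos (ι (+ k)) x<1 ⟩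
    ι (+ k) ℚ.* 1ℚ          ≡⟨ ℚ.*-identityʳ (ι (+ k)) ⟩
    ι (+ k)                 ∎

coprime-^-divisor : ∀ {m n o} i → Coprime m n → m ∣ n ^ i * o → m ∣ o
coprime-^-divisor {m} zero    _   m∣o      = subst (m ∣_) (ℕ.+-identityʳ _) m∣o
coprime-^-divisor {m} {n} {o} (suc i) m⊥n m∣nⁱ⁺¹o = coprime-^-divisor i m⊥n
  (coprime-divisor m⊥n (subst (m ∣_) (ℕ.*-assoc n (n ^ i) o) m∣nⁱ⁺¹o))

n<m^n : ∀ {m} → 1 ℕ.< m → ∀ n → n ℕ.< m ^ n
n<m^n 1<m zero    = s≤s z≤n
n<m^n 1<m (suc n) = ℕ.≤-<-trans (n<m^n 1<m n) (ℕ.^-monoʳ-< _ 1<m (ℕ.n<1+n n))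

k≤g^clogAux : ∀ {g k} fuel L → k ≤ g ^ (L + fuel) → k ≤ g ^ clogAux g k fuel L
k≤g^clogAux {g} {k} zero L k≤g^L = subst (λ e → k ≤ g ^ e) (ℕ.+-identityʳ L) k≤g^L
k≤g^clogAux {g} {k} (suc fuel) L k≤g^[L+1+fuel] with k ℕ.≤? g ^ L
... | yes k≤g^L = k≤g^L
... | no  _     = k≤g^clogAux fuel (suc L) (subst (λ e → k ≤ g ^ e) (ℕ.+-suc L fuel) k≤g^[L+1+fuel])

k≤g^ceilLog : ∀ {g} → 1 ℕ.< g → ∀ k → k ≤ g ^ ceilLog g k
k≤g^ceilLog 1<g k = k≤g^clogAux k 0 (ℕ.<⇒≤ (n<m^n 1<g k))

module Residues (g j k : ℕ) .{{_ : NonZero k}} where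

  α : ℚ
  α = + j / k

  integerPart : ℕ → ℤ
  integerPart i = ℚ.ceiling (gQ (g ^ i) ℚ.* α ℚ.- upperI g)

  residue : ℕ → ℤ
  residue i = + (g ^ i) ℤ.* + j ℤ.- + k ℤ.* integerPart i

  k*fracPart≡residue : ∀ i → ι (+ k) ℚ.* fracPart g α i ≡ ι (residue i)
  k*fracPart≡residue i = begin
    K ℚ.* (G ℚ.* α ℚ.- ι (integerPart i))              ≡⟨ solve 4 (λ K G A C → K :* (G :* A :- C) := G :* (K :* A) :- K :* C)
                                                             refl K G α (ι (integerPart i)) ⟩
    G ℚ.* (K ℚ.* α) ℚ.- K ℚ.* ι (integerPart i)        ≡⟨ cong (λ a → G ℚ.* a ℚ.- K ℚ.* ι (integerPart i)) (ι[k]*[n/k]≡ι[n] (+ j) k) ⟩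
    G ℚ.* ι (+ j) ℚ.- K ℚ.* ι (integerPart i)          ≡⟨ cong₂ ℚ._-_ (ι-homo-* (+ (g ^ i)) (+ j)) (ι-homo-* (+ k) (integerPart i)) ⟨
    ι (+ (g ^ i) ℤ.* + j) ℚ.- ι (+ k ℤ.* integerPart i) ≡⟨ ι-homo-- (+ (g ^ i) ℤ.* + j) (+ k ℤ.* integerPart i) ⟨
    ι (residue i)                                ∎
    where
    open ≡-Reasoning
    open +-*-Solver
    K = ι (+ k)
    G = gQ (g ^ i)

  residue≢0 : Coprime k g → ¬ k ∣ j → ∀ i → residue i ≢ 0ℤ
  residue≢0 k⊥g k∤j i residue≡0 = k∤j (coprime-^-divisor i k⊥g (divides ℤ.∣ integerPart i ∣ gⁱj≡integerPart*k))
    where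
    open ≡-Reasoning
    gⁱj≡integerPart*k : g ^ i * j ≡ ℤ.∣ integerPart i ∣ * k
    gⁱj≡integerPart*k = begin
      g ^ i * j                  ≡⟨ ℤ.abs-* (+ (g ^ i)) (+ j) ⟨
      ℤ.∣ + (g ^ i) ℤ.* + j ∣    ≡⟨ cong ℤ.∣_∣ (ℤ.i-j≡0⇒i≡j (+ (g ^ i) ℤ.* + j) (+ k ℤ.* integerPart i) residue≡0) ⟩
      ℤ.∣ + k ℤ.* integerPart i ∣      ≡⟨ ℤ.abs-* (+ k) (integerPart i) ⟩
      k * ℤ.∣ integerPart i ∣          ≡⟨ ℕ.*-comm k ℤ.∣ integerPart i ∣ ⟩
      ℤ.∣ integerPart i ∣ * k          ∎

  ∣residue∣<k : 3 ≤ g → ∀ i → ℤ.∣ residue i ∣ ℕ.< k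
  ∣residue∣<k 3≤g i = -1<x<1⇒∣k*x∣<k {residue i} (k*fracPart≡residue i)
                        (-1<redI 3≤g (gQ (g ^ i) ℚ.* α)) (redI<1 3≤g (gQ (g ^ i) ℚ.* α))

  residue-suc : ∀ i → digit g α (suc i) ≡ 0ℚ → residue (suc i) ≡ + g ℤ.* residue i
  residue-suc i digit≡0 = ι-injective (begin
    ι (residue (suc i))                    ≡⟨ k*fracPart≡residue (suc i) ⟨
    K ℚ.* fracPart g α (suc i)             ≡⟨ cong (K ℚ.*_) (x∙y⁻¹≈ε⇒x≈y _ _ digit≡0) ⟨
    K ℚ.* (gQ g ℚ.* fracPart g α i)        ≡⟨ solve 3 (λ K G F → K :* (G :* F) := G :* (K :* F)) refl K (gQ g) (fracPart g α i) ⟩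
    gQ g ℚ.* (K ℚ.* fracPart g α i)        ≡⟨ cong (gQ g ℚ.*_) (k*fracPart≡residue i) ⟩
    ι (+ g) ℚ.* ι (residue i)              ≡⟨ ι-homo-* (+ g) (residue i) ⟨
    ι (+ g ℤ.* residue i)                  ∎)
    where
    open ≡-Reasoning
    open +-*-Solver
    K = ι (+ k)

  ∣residue∣>0 : Coprime k g → ¬ k ∣ j → ∀ i → 0 ℕ.< ℤ.∣ residue i ∣
  ∣residue∣>0 k⊥g k∤j i = ℕ.n≢0⇒n>0 (λ ∣residue∣≡0 → residue≢0 k⊥g k∤j i (ℤ.∣i∣≡0⇒i≡0 ∣residue∣≡0))

  ∣residue∣-suc : ∀ i → digit g α (suc i) ≡ 0ℚ → ℤ.∣ residue (suc i) ∣ ≡ g * ℤ.∣ residue i ∣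
  ∣residue∣-suc i digit≡0 = trans (cong ℤ.∣_∣ (residue-suc i digit≡0)) (ℤ.abs-* (+ g) (residue i))

module _ {g : ℕ} .{{_ : NonZero g}} {α : ℚ} {L : ℕ} (n : ℕ → ℕ)
         (n>0 : ∀ i → 0 ℕ.< n i) (n<g^L : ∀ i → n i ℕ.< g ^ L)
         (n-suc : ∀ i → digit g α (suc i) ≡ 0ℚ → n (suc i) ≡ g * n i) where

  private
    run<L : ∀ {z i} → g ^ z ≤ n i → z ℕ.< L
    run<L {z} {i} gᶻ≤nᵢ = ℕ.≰⇒> (λ L≤z → ℕ.≤⇒≯ (ℕ.≤-trans (ℕ.^-monoʳ-≤ g L≤z) gᶻ≤nᵢ) (n<g^L i))

    -- z is the length of the run of zero digits ending at position K.
    trailingZeros : ∀ K → ∃[ z ] g ^ z ≤ n K × K ≤ z + w g K α * L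
    trailingZeros zero = 0 , n>0 0 , z≤n
    trailingZeros (suc K) with trailingZeros K | digit g α (suc K) ℚ.≟ 0ℚ
    ... | z , gᶻ≤nK , K≤z+wL | yes digit≡0 =
      suc z , ℕ.≤-trans (ℕ.*-monoʳ-≤ g gᶻ≤nK) (ℕ.≤-reflexive (sym (n-suc K digit≡0))) , s≤s K≤z+wL
    ... | z , gᶻ≤nK , K≤z+wL | no _ =
      0 , n>0 (suc K) , ℕ.≤-trans (s≤s K≤z+wL) (ℕ.+-monoˡ-≤ (w g K α * L) (run<L gᶻ≤nK))

  K<[w+1]*L : ∀ K → K ℕ.< (w g K α + 1) * L
  K<[w+1]*L K with trailingZeros K
  ... | z , gᶻ≤nK , K≤z+wL = begin-strict
    K                     ≤⟨ K≤z+wL ⟩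
    z + w g K α * L       <⟨ ℕ.+-monoˡ-< (w g K α * L) (run<L gᶻ≤nK) ⟩
    L + w g K α * L       ≡⟨ cong (_* L) (ℕ.+-comm 1 (w g K α)) ⟩
    (w g K α + 1) * L     ∎
    where open ℕ.≤-Reasoning

lemma6p3 : (g K j k : ℕ) → .{{_ : NonZero k}} → g ≥ 3 → K ≥ 1 →
    gcd k g ≡ 1 → ¬ (k ∣ j) →
    K < (w g K ((+ j) / k) + 1) * ceilLog g k
lemma6p3 g K j k 3≤g _ gcd[k,g]≡1 k∤j =
  K<[w+1]*L {{g≢0}} (λ i → ℤ.∣ residue i ∣) (∣residue∣>0 k⊥g k∤j) ∣residue∣<g^L ∣residue∣-suc K
  where
  open Residues g j k
  1<g : 1 ℕ.< g
  1<g = ℕ.≤-trans (s≤s (s≤s z≤n)) 3≤g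
  g≢0 : NonZero g
  g≢0 = ℕ.>-nonZero (ℕ.<-trans (s≤s z≤n) 1<g)
  k⊥g : Coprime k g
  k⊥g = gcd≡1⇒coprime gcd[k,g]≡1
  ∣residue∣<g^L : ∀ i → ℤ.∣ residue i ∣ ℕ.< g ^ ceilLog g k
  ∣residue∣<g^L i = ℕ.<-≤-trans (∣residue∣<k 3≤g i) (k≤g^ceilLog 1<g k)
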